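{- Consider the impartial game \textsc{saliquant} on positive integers. For all integers $a\geq 0$ and $b\geq 1$ there is a nonnegative integer $m$ such that $$\mathcal{SG}\left((2a+1)2^b\right)=\frac{m}{2m+1}\left((2a+1)2^b-1\right)+\frac{1}{2m+1}\left((2a+1)2^{b-1}-a-1\right)=(2a+1)2^{b-1}-\frac{1}{2}\left(\frac{2a+1}{2m+1}+1\right).$$ Consequently, $\mathcal{SG}\left((2a+1)2^b\right)=(2a+1)2^{b-1}-\frac{d+1}{2}$ for some positive divisor $d$ of $2a+1$.
   Context: \textsc{saliquant} is the normal-play impartial game whose positions are the positive integers, where the options of a position $n\geq 1$ are $\{n-k : 1\leq k\leq n,\ k\nmid n\}$ (subtract a non-divisor). The nim-value (Sprague–Grundy value) is defined recursively by $\mathcal{SG}(n)=\operatorname{mex}\{\mathcal{SG}(x) : x \text{ an option of } n\}$, where $\operatorname{mex}(A)$ is the least nonnegative integer not in $A$. -}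

module Defs where

open import Data.Nat using (ℕ; zero; suc; _∸_; _≤ᵇ_; _≡ᵇ_)
open import Data.Nat.Divisibility using (_∣?_)
open import Data.Bool using (Bool; true; false; if_then_else_; _∨_)
open import Data.List using (List; []; _∷_; map; filter; upTo; length)
open import Relation.Nullary.Decidable using (¬?)

elem : ℕ → List ℕ → Bool
elem x []       = false
elem x (y ∷ ys) = (x ≡ᵇ y) ∨ elem x ys

-- mex A = least natural number not in A.  (It is at most length A, so
-- searching 0,1,...,length A suffices.)
mexGo : ℕ → ℕ → List ℕ → ℕ
mexGo zero    i A = i
mexGo (suc f) i A = if elem i A then mexGo f (suc i) A else i

mex : List ℕ → ℕ
mex A = mexGo (length A) 0 A

options : ℕ → List ℕ
options n = map (n ∸_) (filter (λ k → ¬? (k ∣? n)) (map suc (upTo n)))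

-- hist n x = SG(x) for all 1 ≤ x ≤ n (built up by recursion on n).
hist : ℕ → ℕ → ℕ
hist zero    x = 0
hist (suc n) x = if x ≤ᵇ n then hist n x else mex (map (hist n) (options (suc n)))

SG : ℕ → ℕ
SG n = hist n n

-- Every option x of a position m satisfies 0 < x ≤ m − 2, because subtracting
-- 1 or m is never allowed.  By strong induction on q, all positions up to 2q
-- have value below q.  For m = 1 + 2q, the even subtractions never divide m
-- and reach every 1 + 2j with j < q, so SG m = q.  For m = 2 + 2q no option
-- has value q, so w = SG m ≤ q; writing q = w + e, the position 1 + 2w has
-- value w and lies 1 + 2e below m, so it is not an option: d = 1 + 2e divides
-- m, and 2w + d + 1 = m.  For m = (2a + 1) 2^b this odd d divides 2a + 1,
-- say 2a + 1 = (2m' + 1) d, and the stated formulas are rearrangements.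
module Submission where

open import Defs
open import Data.Bool using (true; false; T)
open import Data.Bool.Properties using (∨-zeroʳ)
open import Data.Empty using (⊥-elim)
open import Data.Integer as ℤ using (ℤ; +_)
import Data.Integer.Properties as ℤ
import Data.Integer.Tactic.RingSolver as ℤ-Solver
open import Data.List using (List; []; _∷_; map; upTo; length)
open import Data.List.Membership.Propositional using (_∈_; _∉_)
open import Data.List.Membership.Propositional.Properties
  using (∈-map⁺; ∈-map⁻; ∈-filter⁺; ∈-filter⁻; ∈-upTo⁺; ∈-upTo⁻)
open import Data.List.Properties using (map-cong-local)
open import Data.List.Relation.Unary.All as All using ()
open import Data.List.Relation.Unary.Any using (here; there)
open import Data.Nat
  using (ℕ; zero; suc; _+_; _*_; _^_; _∸_; _≤_; _<_; _≤?_; _≡ᵇ_; _≤ᵇ_; _<ᵇ_; z≤n; s≤s; s≤s⁻¹)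
open import Data.Nat.Coprimality using (Coprime; coprime-divisor)
open import Data.Nat.Divisibility using (_∣_; _∣?_; divides; ∣-refl; ∣-trans; 1∣_; ∣⇒≤; 0∣⇒≡0)
open import Data.Nat.Induction using (<-rec)
open import Data.Nat.Properties
open import Data.Nat.Tactic.RingSolver using (solve-∀)
open import Data.Product using (_×_; _,_; proj₁; proj₂; ∃-syntax)
open import Data.Sum using (inj₁; inj₂)
open import Relation.Nullary using (¬_; yes; no; contradiction)
open import Relation.Nullary.Decidable using (¬?; decidable-stable)
open import Relation.Binary.PropositionalEquality

≡ᵇ-refl : ∀ n → (n ≡ᵇ n) ≡ true
≡ᵇ-refl zero    = refl
≡ᵇ-refl (suc n) = ≡ᵇ-refl n

<ᵇ-irrefl : ∀ n → (n <ᵇ n) ≡ false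
<ᵇ-irrefl zero    = refl
<ᵇ-irrefl (suc n) = <ᵇ-irrefl n

∈⇒elem≡true : ∀ {x A} → x ∈ A → elem x A ≡ true
∈⇒elem≡true {x} (here refl) rewrite ≡ᵇ-refl x = refl
∈⇒elem≡true {x} {y ∷ _} (there x∈A) rewrite ∈⇒elem≡true x∈A = ∨-zeroʳ (x ≡ᵇ y)

elem≡true⇒∈ : ∀ {x} A → elem x A ≡ true → x ∈ A
elem≡true⇒∈ {x} (y ∷ A) elem≡true with x ≡ᵇ y in x≡ᵇy
... | true  = here (≡ᵇ⇒≡ x y (subst T (sym x≡ᵇy) _))
... | false = there (elem≡true⇒∈ A elem≡true)

-- count≥ i A bounds the number of further steps the mex search from i takes.
count≥ : ℕ → List ℕ → ℕ
count≥ i []      = 0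
count≥ i (y ∷ A) with i ≤? y
... | yes _ = suc (count≥ i A)
... | no  _ = count≥ i A

count≥-≤-length : ∀ i A → count≥ i A ≤ length A
count≥-≤-length i []      = z≤n
count≥-≤-length i (y ∷ A) with i ≤? y
... | yes _ = s≤s (count≥-≤-length i A)
... | no  _ = m≤n⇒m≤1+n (count≥-≤-length i A)

count≥-suc-≤ : ∀ i A → count≥ (suc i) A ≤ count≥ i A
count≥-suc-≤ i [] = z≤n
count≥-suc-≤ i (y ∷ A) with suc i ≤? y | i ≤? y
... | yes _   | yes _   = s≤s (count≥-suc-≤ i A)
... | yes i<y | no  i≰y = contradiction (<⇒≤ i<y) i≰y
... | no  _   | yes _   = m≤n⇒m≤1+n (count≥-suc-≤ i A)
... | no  _   | no  _   = count≥-suc-≤ i A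

count≥-suc-< : ∀ {i A} → i ∈ A → count≥ (suc i) A < count≥ i A
count≥-suc-< {i} {y ∷ A} i∈ with suc i ≤? y | i ≤? y | i∈
... | yes i<y | _       | here refl  = contradiction i<y (<-irrefl refl)
... | no  _   | yes _   | here refl  = s≤s (count≥-suc-≤ i A)
... | _       | no  i≰y | here refl  = contradiction ≤-refl i≰y
... | yes _   | yes _   | there i∈A = s≤s (count≥-suc-< i∈A)
... | yes i<y | no  i≰y | there _   = contradiction (<⇒≤ i<y) i≰y
... | no  _   | yes _   | there i∈A = m≤n⇒m≤1+n (count≥-suc-< i∈A)
... | no  _   | no  _   | there i∈A = count≥-suc-< i∈A

mexGo-∉ : ∀ f i A → count≥ i A ≤ f → mexGo f i A ∉ A
mexGo-∉ zero i A count≤0 i∈A = contradiction (<-≤-trans (count≥-suc-< i∈A) count≤0) (λ ())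
mexGo-∉ (suc f) i A count≤f+1 found with elem i A in i∈?A
... | true  = mexGo-∉ f (suc i) A
                (s≤s⁻¹ (<-≤-trans (count≥-suc-< (elem≡true⇒∈ A i∈?A)) count≤f+1)) found
... | false with () ← trans (sym (∈⇒elem≡true found)) i∈?A

mexGo-≤ : ∀ f i A v → i ≤ v → v ∉ A → mexGo f i A ≤ v
mexGo-≤ zero    i A v i≤v v∉A = i≤v
mexGo-≤ (suc f) i A v i≤v v∉A with elem i A in i∈?A
... | false = i≤v
... | true with m≤n⇒m<n∨m≡n i≤v
...   | inj₁ i<v  = mexGo-≤ f (suc i) A v i<v v∉A
...   | inj₂ refl = contradiction (elem≡true⇒∈ A i∈?A) v∉A

mex-∉ : ∀ A → mex A ∉ A
mex-∉ A = mexGo-∉ (length A) 0 A (count≥-≤-length 0 A)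

mex-≤ : ∀ A v → v ∉ A → mex A ≤ v
mex-≤ A v = mexGo-≤ (length A) 0 A v z≤n

hist-suc : ∀ {n y} → y ≤ n → hist (suc n) y ≡ hist n y
hist-suc {n} {y} y≤n with y ≤ᵇ n in y≤ᵇn
... | true  = refl
... | false = ⊥-elim (subst T y≤ᵇn (≤⇒≤ᵇ y≤n))

hist-+ : ∀ y k → hist (y + k) y ≡ SG y
hist-+ y zero    rewrite +-identityʳ y = refl
hist-+ y (suc k) rewrite +-suc y k = trans (hist-suc (m≤m+n y k)) (hist-+ y k)

hist≡SG : ∀ {n y} → y ≤ n → hist n y ≡ SG y
hist≡SG {y = y} y≤n with k , refl ← m≤n⇒∃[o]m+o≡n y≤n = hist-+ y k

infix 4 _⇾_

data _⇾_ (m x : ℕ) : Set where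
  subtract : ∀ k → 0 < k → x + k ≡ m → ¬ (k ∣ m) → m ⇾ x

⇾⇒< : ∀ {m x} → m ⇾ x → x < m
⇾⇒< {m} {x} (subtract (suc k) _ x+k≡m _) = subst (x <_) x+k≡m (m<m+n x (s≤s z≤n))

∈-options⁻ : ∀ {m x} → x ∈ options m → m ⇾ x
∈-options⁻ {m} x∈ with ∈-map⁻ (m ∸_) x∈
... | k , k∈ , refl with ∈-filter⁻ (λ k → ¬? (k ∣? m)) {xs = map suc (upTo m)} k∈
... | k∈suc , k∤m with ∈-map⁻ suc k∈suc
... | j , j∈ , refl = subtract (suc j) (s≤s z≤n) (m∸n+n≡m (∈-upTo⁻ j∈)) k∤m

⇾⇒∈-options : ∀ {m x} → m ⇾ x → x ∈ options m
⇾⇒∈-options {m} {x} (subtract (suc j) _ x+k≡m k∤m) =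
  subst (_∈ options m) m∸k≡x
    (∈-map⁺ (m ∸_) (∈-filter⁺ (λ k → ¬? (k ∣? m)) (∈-map⁺ suc (∈-upTo⁺ k≤m)) k∤m))
  where
  k≤m : suc j ≤ m
  k≤m = subst (suc j ≤_) x+k≡m (m≤n+m (suc j) x)
  m∸k≡x : m ∸ suc j ≡ x
  m∸k≡x = subst (λ m → m ∸ suc j ≡ x) x+k≡m (m+n∸n≡m x (suc j))

SG-suc : ∀ n → SG (suc n) ≡ mex (map SG (options (suc n)))
SG-suc n rewrite <ᵇ-irrefl n =
  cong mex (map-cong-local {xs = options (suc n)}
    (All.tabulate λ x∈ → hist≡SG (s≤s⁻¹ (⇾⇒< (∈-options⁻ x∈)))))

SG-⇾-≢ : ∀ {n x} → suc n ⇾ x → SG x ≢ SG (suc n)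
SG-⇾-≢ {n} o SGx≡SGm =
  mex-∉ _ (subst (_∈ _) (trans SGx≡SGm (SG-suc n)) (∈-map⁺ SG (⇾⇒∈-options o)))

SG-≤ : ∀ n v → (∀ {x} → suc n ⇾ x → SG x ≢ v) → SG (suc n) ≤ v
SG-≤ n v unreached rewrite SG-suc n = mex-≤ _ v v∉
  where
  v∉ : v ∉ map SG (options (suc n))
  v∉ v∈ with x , x∈ , v≡SGx ← ∈-map⁻ SG v∈ = unreached (∈-options⁻ x∈) (sym v≡SGx)

SG-≡ : ∀ n q → (∀ {x} → suc n ⇾ x → SG x ≢ q) →
       (∀ j → j < q → ∃[ x ] (suc n ⇾ x × SG x ≡ j)) → SG (suc n) ≡ q
SG-≡ n q unreached reached with m≤n⇒m<n∨m≡n (SG-≤ n q unreached)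
... | inj₂ SGm≡q = SGm≡q
... | inj₁ SGm<q with x , o , SGx≡SGm ← reached _ SGm<q = contradiction SGx≡SGm (SG-⇾-≢ o)

data Parity : ℕ → Set where
  zero : Parity 0
  odd  : ∀ q → Parity (1 + 2 * q)
  even : ∀ q → Parity (2 + 2 * q)

parity : ∀ n → Parity n
parity zero = zero
parity (suc n) with parity n
... | zero   = odd 0
... | odd q  = even q
... | even q = subst Parity (cong (λ n → 2 + n) (+-suc q (1 * q))) (odd (suc q))

2∤odd : ∀ q → ¬ (2 ∣ 1 + 2 * q)
2∤odd q (divides c 1+2q≡c*2) = even≢odd c q (sym (trans 1+2q≡c*2 (*-comm c 2)))

⇾-bounds : ∀ {m x} → m ⇾ x → 0 < x × 2 + x ≤ m
⇾-bounds (subtract zero () _ _)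
⇾-bounds (subtract 1 _ _ 1∤m) = contradiction (1∣ _) 1∤m
⇾-bounds {x = zero} (subtract k _ k≡m k∤m) = contradiction (subst (k ∣_) k≡m ∣-refl) k∤m
⇾-bounds {x = suc x} (subtract (suc (suc j)) _ x+k≡m _) =
  s≤s z≤n , subst (3 + x ≤_) (trans (+-comm (2 + j) (suc x)) x+k≡m) (s≤s (s≤s (m≤n+m (suc x) j)))

SGViaOddDivisor : ℕ → Set
SGViaOddDivisor y = ∃[ t ] (1 + 2 * t ∣ y × 2 * SG y + (2 + 2 * t) ≡ y)

SGFormulas : ℕ → Set
SGFormulas q = SG (1 + 2 * q) ≡ q × SGViaOddDivisor (2 + 2 * q)

viaOddDivisor⇒SG≤ : ∀ q → SGViaOddDivisor (2 + 2 * q) → SG (2 + 2 * q) ≤ q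
viaOddDivisor⇒SG≤ q (t , _ , gap) = *-cancelˡ-≤ 2 (begin
  2 * SG (2 + 2 * q)              ≤⟨ m≤m+n _ (2 * t) ⟩
  2 * SG (2 + 2 * q) + 2 * t      ≡⟨ +-cancelˡ-≡ 2 _ _ (trans (shuffle (SG (2 + 2 * q)) t) gap) ⟩
  2 * q                           ∎)
  where
  open ≤-Reasoning
  shuffle : ∀ s t → 2 + (2 * s + 2 * t) ≡ 2 * s + (2 + 2 * t)
  shuffle = solve-∀

SG-below : ∀ {q x} → (∀ {r} → r < q → SGFormulas r) → 0 < x → x ≤ 2 * q → SG x < q
SG-below {q} {x} ih 0<x x≤2q with parity x
... | zero   = contradiction 0<x (<-irrefl refl)
... | odd r  = subst (_< q) (sym (proj₁ (ih r<q))) r<q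
  where
  r<q : r < q
  r<q = *-cancelˡ-< 2 r q x≤2q
... | even r = ≤-<-trans (viaOddDivisor⇒SG≤ r (proj₂ (ih r<q))) r<q
  where
  r<q : r < q
  r<q = *-cancelˡ-≤ 2 (subst (_≤ 2 * q) (sym (*-distribˡ-+ 2 1 r)) x≤2q)

SG-⇾-< : ∀ {q m x} → (∀ {r} → r < q → SGFormulas r) → m ≤ 2 + 2 * q → m ⇾ x → SG x < q
SG-⇾-< ih m≤2+2q o with 0<x , 2+x≤m ← ⇾-bounds o =
  SG-below ih 0<x (+-cancelˡ-≤ 2 _ _ (≤-trans 2+x≤m m≤2+2q))

SG-odd-step : ∀ {q} → (∀ {r} → r < q → SGFormulas r) → SG (1 + 2 * q) ≡ q
SG-odd-step {q} ih = SG-≡ (2 * q) q (λ o → <⇒≢ (SG-⇾-< ih (n≤1+n _) o)) reached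
  where
  identity : ∀ j e → 1 + 2 * j + (2 + 2 * e) ≡ 1 + 2 * (suc j + e)
  identity = solve-∀
  even-k : ∀ e → 2 + 2 * e ≡ (1 + e) * 2
  even-k = solve-∀
  reached : ∀ j → j < q → ∃[ x ] (1 + 2 * q ⇾ x × SG x ≡ j)
  reached j j<q with e , j+1+e≡q ← m≤n⇒∃[o]m+o≡n j<q =
    1 + 2 * j ,
    subtract (2 + 2 * e) (s≤s z≤n) (trans (identity j e) (cong (λ n → 1 + 2 * n) j+1+e≡q))
      (λ k∣m → 2∤odd q (∣-trans (divides (1 + e) (even-k e)) k∣m)) ,
    proj₁ (ih j<q)

SG-even-step : ∀ {q} → (∀ {r} → r < q → SGFormulas r) → SG (1 + 2 * q) ≡ q →
               SGViaOddDivisor (2 + 2 * q)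
SG-even-step {q} ih SG-odd-q = e , k∣m , gap
  where
  w = SG (2 + 2 * q)
  w≤q : w ≤ q
  w≤q = SG-≤ (1 + 2 * q) q (λ o → <⇒≢ (SG-⇾-< ih ≤-refl o))
  e = q ∸ w
  w+e≡q : w + e ≡ q
  w+e≡q = m+[n∸m]≡n w≤q
  SG-odd-w : SG (1 + 2 * w) ≡ w
  SG-odd-w with m≤n⇒m<n∨m≡n w≤q
  ... | inj₁ w<q = proj₁ (ih w<q)
  ... | inj₂ w≡q = subst (λ r → SG (1 + 2 * r) ≡ r) (sym w≡q) SG-odd-q
  identity₁ : ∀ w e → 1 + 2 * w + (1 + 2 * e) ≡ 2 + 2 * (w + e)
  identity₁ = solve-∀
  identity₂ : ∀ w e → 2 * w + (2 + 2 * e) ≡ 2 + 2 * (w + e)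
  identity₂ = solve-∀
  k∣m : 1 + 2 * e ∣ 2 + 2 * q
  k∣m = decidable-stable (_ ∣? _) λ k∤m →
    SG-⇾-≢ (subtract (1 + 2 * e) (s≤s z≤n)
             (trans (identity₁ w e) (cong (λ n → 2 + 2 * n) w+e≡q)) k∤m) SG-odd-w
  gap : 2 * w + (2 + 2 * e) ≡ 2 + 2 * q
  gap = trans (identity₂ w e) (cong (λ n → 2 + 2 * n) w+e≡q)

SG-formulas : ∀ q → SGFormulas q
SG-formulas = <-rec SGFormulas λ q ih →
  let SG-odd-q = SG-odd-step ih in SG-odd-q , SG-even-step ih SG-odd-q

SG-double : ∀ X → 0 < X → SGViaOddDivisor (2 * X)
SG-double (suc q) _ = subst SGViaOddDivisor (sym (*-distribˡ-+ 2 1 q)) (proj₂ (SG-formulas q))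

odd-coprimeTo-2 : ∀ t → Coprime (1 + 2 * t) 2
odd-coprimeTo-2 t {0} (_ , 0∣2) with () ← 0∣⇒≡0 0∣2
odd-coprimeTo-2 t {1} _ = refl
odd-coprimeTo-2 t {2} (2∣odd , _) = contradiction 2∣odd (2∤odd t)
odd-coprimeTo-2 t {suc (suc (suc _))} (_ , d∣2) with s≤s (s≤s ()) ← ∣⇒≤ d∣2

coprime-divisor-^ : ∀ {m n o} b → Coprime m n → m ∣ n ^ b * o → m ∣ o
coprime-divisor-^ {o = o} zero _ m∣o = subst (_ ∣_) (*-identityˡ o) m∣o
coprime-divisor-^ {m} {n} {o} (suc b) coprime m∣ =
  coprime-divisor-^ b coprime (coprime-divisor coprime (subst (m ∣_) (*-assoc n (n ^ b) o) m∣))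

odd-cofactor : ∀ {t a} → 1 + 2 * t ∣ 1 + 2 * a → ∃[ m ] (1 + 2 * a ≡ (1 + 2 * m) * (1 + 2 * t))
odd-cofactor {t} {a} (divides c a≡ct) with parity c
... | zero   with () ← a≡ct
... | odd m  = m , a≡ct
... | even m = contradiction (sym (trans a≡ct (factor m t))) (even≢odd ((1 + m) * (1 + 2 * t)) a)
  where
  factor : ∀ m t → (2 + 2 * m) * (1 + 2 * t) ≡ 2 * ((1 + m) * (1 + 2 * t))
  factor = solve-∀

*-2^-suc : ∀ o b → o * 2 ^ suc b ≡ 2 * (o * 2 ^ b)
*-2^-suc o b = doubling o (2 ^ b)
  where
  doubling : ∀ o p → o * (2 * p) ≡ 2 * (o * p)
  doubling = solve-∀

SG-odd·2^suc : ∀ a b → ∃[ t ] (1 + 2 * t ∣ 2 * a + 1 ×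
  2 * SG ((2 * a + 1) * 2 ^ suc b) + (2 + 2 * t) ≡ 2 * ((2 * a + 1) * 2 ^ b))
SG-odd·2^suc a b =
  let t , d∣y , gap = subst SGViaOddDivisor (sym y≡2X) (SG-double X 0<X)
  in t
   , coprime-divisor-^ (suc b) (odd-coprimeTo-2 t)
       (subst (1 + 2 * t ∣_) (*-comm (2 * a + 1) (2 ^ suc b)) d∣y)
   , trans gap y≡2X
  where
  X = (2 * a + 1) * 2 ^ b
  0<X : 0 < X
  0<X = *-mono-≤ (m≤n+m 1 (2 * a)) (m^n>0 2 b)
  y≡2X : (2 * a + 1) * 2 ^ suc b ≡ 2 * X
  y≡2X = *-2^-suc (2 * a + 1) b

m+n≡o⇒[+m]≡[+o]-[+n] : ∀ {m n o} → m + n ≡ o → + m ≡ + o ℤ.- + n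
m+n≡o⇒[+m]≡[+o]-[+n] {m} {n} {o} m+n≡o = begin
  + m                 ≡⟨ cancel (+ m) (+ n) ⟩
  + m ℤ.+ + n ℤ.- + n ≡⟨ cong (ℤ._- + n) (sym (ℤ.pos-+ m n)) ⟩
  + (m + n) ℤ.- + n   ≡⟨ cong (λ k → + k ℤ.- + n) m+n≡o ⟩
  + o ℤ.- + n         ∎
  where
  open ≡-Reasoning
  cancel : ∀ x y → x ≡ x ℤ.+ y ℤ.- y
  cancel = ℤ-Solver.solve-∀

module SGIdentities {a m t S X : ℕ} (gap : 2 * S + (2 + 2 * t) ≡ 2 * X)
         (cofactor : 1 + 2 * a ≡ (1 + 2 * m) * (1 + 2 * t)) where

  private
    scaled-gap : (2 * m + 1) * (2 * S) + (1 + 2 * a) + (2 * m + 1) ≡ (2 * m + 1) * (2 * X)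
    scaled-gap = begin
      (2 * m + 1) * (2 * S) + (1 + 2 * a) + (2 * m + 1)
        ≡⟨ cong (λ k → (2 * m + 1) * (2 * S) + k + (2 * m + 1)) cofactor ⟩
      (2 * m + 1) * (2 * S) + (1 + 2 * m) * (1 + 2 * t) + (2 * m + 1)
        ≡⟨ factor m S t ⟩
      (2 * m + 1) * (2 * S + (2 + 2 * t))
        ≡⟨ cong ((2 * m + 1) *_) gap ⟩
      (2 * m + 1) * (2 * X) ∎
      where
      open ≡-Reasoning
      factor : ∀ m S t → (2 * m + 1) * (2 * S) + (1 + 2 * m) * (1 + 2 * t) + (2 * m + 1)
                         ≡ (2 * m + 1) * (2 * S + (2 + 2 * t))
      factor = solve-∀

    first-identityℕ : (2 * m + 1) * S + (m + a + 1) ≡ m * (2 * X) + X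
    first-identityℕ = *-cancelˡ-≡ _ _ 2 (begin
      2 * ((2 * m + 1) * S + (m + a + 1))                 ≡⟨ expand m S a ⟩
      (2 * m + 1) * (2 * S) + (1 + 2 * a) + (2 * m + 1)   ≡⟨ scaled-gap ⟩
      (2 * m + 1) * (2 * X)                               ≡⟨ regroup m X ⟩
      2 * (m * (2 * X) + X)                               ∎)
      where
      open ≡-Reasoning
      expand : ∀ m S a → 2 * ((2 * m + 1) * S + (m + a + 1))
                         ≡ (2 * m + 1) * (2 * S) + (1 + 2 * a) + (2 * m + 1)
      expand = solve-∀
      regroup : ∀ m X → (2 * m + 1) * (2 * X) ≡ 2 * (m * (2 * X) + X)
      regroup = solve-∀

    second-identityℕ : 2 * (2 * m + 1) * S + ((2 * a + 1) + (2 * m + 1)) ≡ 2 * (2 * m + 1) * X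
    second-identityℕ = begin
      2 * (2 * m + 1) * S + ((2 * a + 1) + (2 * m + 1))   ≡⟨ expand m S a ⟩
      (2 * m + 1) * (2 * S) + (1 + 2 * a) + (2 * m + 1)   ≡⟨ scaled-gap ⟩
      (2 * m + 1) * (2 * X)                               ≡⟨ regroup m X ⟩
      2 * (2 * m + 1) * X                                 ∎
      where
      open ≡-Reasoning
      expand : ∀ m S a → 2 * (2 * m + 1) * S + ((2 * a + 1) + (2 * m + 1))
                         ≡ (2 * m + 1) * (2 * S) + (1 + 2 * a) + (2 * m + 1)
      expand = solve-∀
      regroup : ∀ m X → (2 * m + 1) * (2 * X) ≡ 2 * (2 * m + 1) * X
      regroup = solve-∀

  first-identity : ∀ {N} → N ≡ 2 * X → + (2 * m + 1) ℤ.* + S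
                   ≡ + m ℤ.* (+ N ℤ.- + 1) ℤ.+ (+ X ℤ.- + a ℤ.- + 1)
  first-identity refl = begin
    + (2 * m + 1) ℤ.* + S                          ≡⟨ ℤ.pos-* (2 * m + 1) S ⟨
    + ((2 * m + 1) * S)                            ≡⟨ m+n≡o⇒[+m]≡[+o]-[+n] first-identityℕ ⟩
    + (m * (2 * X) + X) ℤ.- + (m + a + 1)          ≡⟨ cong₂ ℤ._-_ lhs rhs ⟩
    (+ m ℤ.* + (2 * X) ℤ.+ + X) ℤ.- (+ m ℤ.+ + a ℤ.+ + 1) ≡⟨ rearrange (+ m) (+ (2 * X)) (+ X) (+ a) ⟩
    + m ℤ.* (+ (2 * X) ℤ.- + 1) ℤ.+ (+ X ℤ.- + a ℤ.- + 1) ∎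
    where
    open ≡-Reasoning
    lhs : + (m * (2 * X) + X) ≡ + m ℤ.* + (2 * X) ℤ.+ + X
    lhs = trans (ℤ.pos-+ (m * (2 * X)) X) (cong (ℤ._+ + X) (ℤ.pos-* m (2 * X)))
    rhs : + (m + a + 1) ≡ + m ℤ.+ + a ℤ.+ + 1
    rhs = trans (ℤ.pos-+ (m + a) 1) (cong (ℤ._+ + 1) (ℤ.pos-+ m a))
    rearrange : ∀ M N X A → (M ℤ.* N ℤ.+ X) ℤ.- (M ℤ.+ A ℤ.+ + 1)
                            ≡ M ℤ.* (N ℤ.- + 1) ℤ.+ (X ℤ.- A ℤ.- + 1)
    rearrange = ℤ-Solver.solve-∀

  second-identity : + (2 * (2 * m + 1)) ℤ.* + S
                    ≡ + (2 * (2 * m + 1)) ℤ.* + X ℤ.- (+ (2 * a + 1) ℤ.+ + (2 * m + 1))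
  second-identity = begin
    + (2 * (2 * m + 1)) ℤ.* + S                   ≡⟨ ℤ.pos-* (2 * (2 * m + 1)) S ⟨
    + (2 * (2 * m + 1) * S)                       ≡⟨ m+n≡o⇒[+m]≡[+o]-[+n] second-identityℕ ⟩
    + (2 * (2 * m + 1) * X) ℤ.- + ((2 * a + 1) + (2 * m + 1))
      ≡⟨ cong₂ ℤ._-_ (ℤ.pos-* (2 * (2 * m + 1)) X) (ℤ.pos-+ (2 * a + 1) (2 * m + 1)) ⟩
    + (2 * (2 * m + 1)) ℤ.* + X ℤ.- (+ (2 * a + 1) ℤ.+ + (2 * m + 1)) ∎
    where open ≡-Reasoning

mainTheorem1 : (a b : ℕ) → 1 ≤ b →
    (∃[ m ]
      (((+ (2 * m + 1)) ℤ.* (+ SG ((2 * a + 1) * 2 ^ b))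
          ≡ (+ m) ℤ.* ((+ ((2 * a + 1) * 2 ^ b)) ℤ.- (+ 1))
            ℤ.+ ((+ ((2 * a + 1) * 2 ^ (b ∸ 1))) ℤ.- (+ a) ℤ.- (+ 1)))
       ×
       ((+ (2 * (2 * m + 1))) ℤ.* (+ SG ((2 * a + 1) * 2 ^ b))
          ≡ (+ (2 * (2 * m + 1))) ℤ.* (+ ((2 * a + 1) * 2 ^ (b ∸ 1)))
            ℤ.- ((+ (2 * a + 1)) ℤ.+ (+ (2 * m + 1))))))
    ×
    (∃[ d ] (d ∣ 2 * a + 1 × 1 ≤ d
      × 2 * SG ((2 * a + 1) * 2 ^ b) + (d + 1) ≡ 2 * ((2 * a + 1) * 2 ^ (b ∸ 1))))
mainTheorem1 a (suc b) _ with SG-odd·2^suc a b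
... | t , d∣2a+1 , gap with odd-cofactor {t} {a} (subst (1 + 2 * t ∣_) (+-comm (2 * a) 1) d∣2a+1)
...   | m , cofactor =
  (m , first-identity (*-2^-suc (2 * a + 1) b) , second-identity) ,
  (1 + 2 * t , d∣2a+1 , s≤s z≤n , trans (cong (λ k → 2 * S + k) (+-comm (1 + 2 * t) 1)) gap)
  where
  S = SG ((2 * a + 1) * 2 ^ suc b)
  X = (2 * a + 1) * 2 ^ b
  open SGIdentities {a} {m} {t} {S} {X} gap cofactor
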